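{- Let $k$ be a perfect field of characteristic different from $2$, let $g$ be a positive integer, and let $f\in k[X]$ be a polynomial of degree $2g+2$ whose leading coefficient is not a square in $k^\times$, such that $Y^2=f$ defines a hyperelliptic curve $\mathcal C$ of genus $g$ (i.e. $f$ has no repeated roots). Let $K=k(X)[Y]/(Y^2-f)$ be its function field, $\mathcal Q=k(X)$, and $\mathcal O_K=k[X,Y]/(Y^2-f)$ (the integral closure of $k[X]$ in $K$). Then \[M(K)=2g.\]
   Context: On $\mathcal Q$, $\deg$ is the degree at infinity: $\deg(a/b)=\deg(a)-\deg(b)$ for polynomials $a,b\neq0$, and $\deg(0)=-\infty$. The Euclidean minimum is \[M(K)=\max_{x\in K}\min_{y\in\mathcal O_K}\deg\big(N_{K/\mathcal Q}(x-y)\big).\] (Equivalently, $\mathcal O_K$ is the ring of functions on $\mathcal C$ regular outside the two points at infinity, which are conjugate under $\mathrm{Gal}(\bar k/k)$.) -}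

module Defs where

open import Level using (Level; _⊔_; suc)
open import Algebra.Bundles using (CommutativeRing)
open import Data.Nat as ℕ using (ℕ; zero; _<_)
open import Data.List using (List; []; _∷_)
open import Data.Product using (Σ; _×_; _,_; ∃)
open import Relation.Nullary using (¬_)
open import Data.Nat.Primality using (Prime)

record Field (c ℓ : Level) : Set (suc (c ⊔ ℓ)) where
  field
    commutativeRing : CommutativeRing c ℓ
  open CommutativeRing commutativeRing public
  field
    1≉0     : ¬ (1# ≈ 0#)
    inverse : ∀ x → ¬ (x ≈ 0#) → Σ Carrier λ y → x * y ≈ 1#

module FieldTheory {c ℓ} (F : Field c ℓ) where
  open Field F

  _·1 : ℕ → Carrier
  zero ·1 = 0#
  ℕ.suc n ·1 = 1# + (n ·1)

  pow : Carrier → ℕ → Carrier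
  pow x zero = 1#
  pow x (ℕ.suc n) = x * pow x n

  CharNot2 : Set ℓ
  CharNot2 = ¬ ((2 ·1) ≈ 0#)

  -- perfect: if the characteristic is a prime p, every element has a p-th root
  -- (characteristic 0 fields are perfect vacuously)
  Perfect : Set (c ⊔ ℓ)
  Perfect = ∀ p → Prime p → (p ·1) ≈ 0# → ∀ a → Σ Carrier λ b → pow b p ≈ a

  IsSquare : Carrier → Set (c ⊔ ℓ)
  IsSquare a = Σ Carrier λ b → b * b ≈ a

  -- Polynomials in k[X]: coefficient lists, constant term first.

  Poly : Set c
  Poly = List Carrier

  coeff : Poly → ℕ → Carrier
  coeff [] _ = 0#
  coeff (a ∷ p) zero = a
  coeff (a ∷ p) (ℕ.suc i) = coeff p i

  infixl 6 _+ₚ_ _-ₚ_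
  infixl 7 _*ₚ_ _·ₚ_

  _+ₚ_ : Poly → Poly → Poly
  [] +ₚ q = q
  (a ∷ p) +ₚ [] = a ∷ p
  (a ∷ p) +ₚ (b ∷ q) = (a + b) ∷ (p +ₚ q)

  _·ₚ_ : Carrier → Poly → Poly
  a ·ₚ [] = []
  a ·ₚ (b ∷ q) = (a * b) ∷ (a ·ₚ q)

  -ₚ_ : Poly → Poly
  -ₚ p = (- 1#) ·ₚ p

  _-ₚ_ : Poly → Poly → Poly
  p -ₚ q = p +ₚ (-ₚ q)

  _*ₚ_ : Poly → Poly → Poly
  [] *ₚ q = []
  (a ∷ p) *ₚ q = (a ·ₚ q) +ₚ (0# ∷ (p *ₚ q))

  deriv : Poly → Poly
  deriv [] = []
  deriv (a ∷ p) = go 1 p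
    where
      go : ℕ → Poly → Poly
      go n [] = []
      go n (b ∷ q) = ((n ·1) * b) ∷ go (ℕ.suc n) q

  oneₚ : Poly
  oneₚ = 1# ∷ []

  _≈ₚ_ : Poly → Poly → Set ℓ
  p ≈ₚ q = ∀ i → coeff p i ≈ coeff q i

  -- deg p ≤ n  (includes p = 0, whose degree is -∞)
  DegLE : Poly → ℕ → Set ℓ
  DegLE p n = ∀ i → n < i → coeff p i ≈ 0#

  DegEq : Poly → ℕ → Set ℓ
  DegEq p n = DegLE p n × ¬ (coeff p n ≈ 0#)

  -- f has no repeated roots (in an algebraic closure): f is separable,
  -- i.e. f and f' generate the unit ideal of k[X].
  Separable : Poly → Set (c ⊔ ℓ)
  Separable f = Σ Poly λ u → Σ Poly λ v → ((u *ₚ f) +ₚ (v *ₚ deriv f)) ≈ₚ oneₚ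

  -- Every element of K is written (p + q Y)/r with
  -- p q r ∈ k[X], r ≠ 0; every element of O_K = k[X,Y]/(Y²-f) is c + d Y.
  -- For x = (p + qY)/r and y = c + dY,
  --   N_{K/Q}(x - y) = ((p - r c)² - f (q - r d)²) / r²,
  -- so with deg r = m, deg N(x-y) = deg(numerator) - 2m.

  normNum : (f p q r c d : Poly) → Poly
  normNum f p q r c d =
    ((p -ₚ (r *ₚ c)) *ₚ (p -ₚ (r *ₚ c))) -ₚ (f *ₚ ((q -ₚ (r *ₚ d)) *ₚ (q -ₚ (r *ₚ d))))

  NormDegLE : (f p q r : Poly) (m : ℕ) (c d : Poly) (n : ℕ) → Set ℓ
  NormDegLE f p q r m c d n = DegLE (normNum f p q r c d) (n ℕ.+ 2 ℕ.* m)

  -- M(K) = n, with max and min attained: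
  --  * every x ∈ K has some y ∈ O_K with deg N(x-y) ≤ n, and
  --  * some x ∈ K has deg N(x-y) ≥ n (i.e. not < n) for all y ∈ O_K.
  -- (n ≥ 1 is assumed by callers so that "< n" is "≤ n-1".)
  EuclideanMinimumIs : (f : Poly) (n : ℕ) → Set (c ⊔ ℓ)
  EuclideanMinimumIs f n =
    (∀ p q r m → DegEq r m → Σ Poly λ c → Σ Poly λ d → NormDegLE f p q r m c d n)
    × (Σ Poly λ p → Σ Poly λ q → Σ Poly λ r → Σ ℕ λ m → DegEq r m ×
        (∀ c d → ¬ NormDegLE f p q r m c d (ℕ.pred n)))

open FieldTheory public

{-# OPTIONS --safe #-}
-- Write x = (p + qY)/r. Dividing p and q by r with remainder gives y ∈ O_K with
-- x − y = (s + tY)/r and deg s, deg t < deg r, so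
-- deg N(x − y) = deg(s² − f t²) − 2 deg r ≤ 2g. Conversely, as the leading
-- coefficient of f is not a square, the leading terms of s² and f t² cannot
-- cancel, so deg(s² − f t²) ≥ 2g + 2 whenever t ≠ 0. For x = Y/X every
-- x − y = (s + tY)/X has t(0) = 1, whence deg N(x − y) ≥ 2g + 2 − 2 = 2g.
module Submission where

open import Defs using (Field; module FieldTheory)
open import Level using (Level)
open import Data.Empty using (⊥)
open import Data.Sum using (_⊎_; inj₁; inj₂)
open import Data.Product using (Σ; ∃; _,_; proj₁)
open import Data.List using ([]; _∷_)
open import Data.Nat as ℕ using (ℕ; zero; suc; _≤_; z≤n; s≤s)
open import Data.Nat.Properties using (≤-refl; ≤-trans; ≤-reflexive; <⇒≤; m≤m+n; m≤n+m; m≤n⇒m<n∨m≡n; <-cmp)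
open import Data.Nat.Tactic.RingSolver using (solve-∀)
open import Relation.Binary.PropositionalEquality as ≡ using (_≡_)
open import Relation.Binary.Definitions using (tri<; tri≈; tri>)
open import Relation.Nullary using (¬_; yes; no)
open import Relation.Nullary.Decidable using (¬¬-excluded-middle)
import Algebra.Properties.Ring as RingProperties
import Algebra.Properties.Group as GroupProperties
import Algebra.Properties.AbelianGroup as AbelianGroupProperties
import Algebra.Properties.CommutativeSemigroup as CommutativeSemigroupProperties

module _ {c ℓ} (F : Field c ℓ) where
  open Field F
  open FieldTheory F
  open RingProperties ring using (-1*x≈-x)
  open GroupProperties +-group using (ε⁻¹≈ε; x∙y⁻¹≈ε⇒x≈y; x≈y⇒x∙y⁻¹≈ε)
  open AbelianGroupProperties +-abelianGroup using (⁻¹-∙-comm)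
  open CommutativeSemigroupProperties *-commutativeSemigroup using (interchange)
  open CommutativeSemigroupProperties +-commutativeSemigroup using (x∙yz≈y∙xz)
  open import Relation.Binary.Reasoning.Setoid setoid

  private variable
    m n : ℕ
    x y : Carrier

  -- DegLE p n is DegLT p (suc n) by definition; DegLT p 0 says p = 0.
  DegLT : Poly → ℕ → Set ℓ
  DegLT p n = ∀ i → n ≤ i → coeff p i ≈ 0#

  0-0≈0 : 0# - 0# ≈ 0#
  0-0≈0 = trans (+-identityˡ _) ε⁻¹≈ε

  +-zeros : x ≈ 0# → y ≈ 0# → x + y ≈ 0#
  +-zeros x≈0 y≈0 = trans (+-cong x≈0 y≈0) (+-identityʳ 0#)

  *-nonzero : ¬ x ≈ 0# → ¬ y ≈ 0# → ¬ x * y ≈ 0#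
  *-nonzero {x} {y} x≉0 y≉0 xy≈0 with inverse x x≉0
  ... | x⁻¹ , xx⁻¹≈1 = y≉0 (begin
    y              ≈⟨ *-identityˡ y ⟨
    1# * y         ≈⟨ *-congʳ (trans (*-comm x⁻¹ x) xx⁻¹≈1) ⟨
    x⁻¹ * x * y    ≈⟨ *-assoc x⁻¹ x y ⟩
    x⁻¹ * (x * y)  ≈⟨ *-congˡ xy≈0 ⟩
    x⁻¹ * 0#       ≈⟨ zeroʳ x⁻¹ ⟩
    0#             ∎)

  square-of-ratio : ∀ {a β} → y * β ≈ 1# → x * x ≈ a * (y * y) → IsSquare a
  square-of-ratio {y} {x} {a} {β} yβ≈1 x²≈ay² = x * β , (begin
    x * β * (x * β)    ≈⟨ interchange x β x β ⟩
    x * x * (β * β)    ≈⟨ *-congʳ x²≈ay² ⟩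
    a * (y * y) * (β * β)  ≈⟨ *-assoc a _ _ ⟩
    a * (y * y * (β * β))  ≈⟨ *-congˡ (interchange y y β β) ⟩
    a * (y * β * (y * β))  ≈⟨ *-congˡ (trans (*-cong yβ≈1 yβ≈1) (*-identityʳ 1#)) ⟩
    a * 1#                 ≈⟨ *-identityʳ a ⟩
    a                      ∎)

  coeff-+ₚ : ∀ p q i → coeff (p +ₚ q) i ≈ coeff p i + coeff q i
  coeff-+ₚ []      q       i       = sym (+-identityˡ _)
  coeff-+ₚ (a ∷ p) []      i       = sym (+-identityʳ _)
  coeff-+ₚ (a ∷ p) (b ∷ q) zero    = refl
  coeff-+ₚ (a ∷ p) (b ∷ q) (suc i) = coeff-+ₚ p q i

  coeff-·ₚ : ∀ a p i → coeff (a ·ₚ p) i ≈ a * coeff p i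
  coeff-·ₚ a []      i       = sym (zeroʳ a)
  coeff-·ₚ a (b ∷ p) zero    = refl
  coeff-·ₚ a (b ∷ p) (suc i) = coeff-·ₚ a p i

  coeff--ₚ : ∀ p q i → coeff (p -ₚ q) i ≈ coeff p i - coeff q i
  coeff--ₚ p q i =
    trans (coeff-+ₚ p (-ₚ q) i) (+-congˡ (trans (coeff-·ₚ (- 1#) q i) (-1*x≈-x _)))

  coeff-∷*ₚ : ∀ a p q i → coeff ((a ∷ p) *ₚ q) i ≈ a * coeff q i + coeff (0# ∷ (p *ₚ q)) i
  coeff-∷*ₚ a p q i = trans (coeff-+ₚ (a ·ₚ q) _ i) (+-congʳ (coeff-·ₚ a q i))

  coeff-*ₚ∷ : ∀ p a q i → coeff (p *ₚ (a ∷ q)) i ≈ a * coeff p i + coeff (0# ∷ (p *ₚ q)) i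
  coeff-*ₚ∷ []      a q zero    = sym (+-zeros (zeroʳ a) refl)
  coeff-*ₚ∷ []      a q (suc i) = sym (+-zeros (zeroʳ a) refl)
  coeff-*ₚ∷ (b ∷ p) a q zero    = +-congʳ (*-comm b a)
  coeff-*ₚ∷ (b ∷ p) a q (suc i) = begin
    coeff (b ·ₚ q +ₚ p *ₚ (a ∷ q)) i                  ≈⟨ coeff-+ₚ (b ·ₚ q) _ i ⟩
    coeff (b ·ₚ q) i + coeff (p *ₚ (a ∷ q)) i          ≈⟨ +-cong (coeff-·ₚ b q i) (coeff-*ₚ∷ p a q i) ⟩
    b * coeff q i + (a * coeff p i + coeff (0# ∷ (p *ₚ q)) i)  ≈⟨ x∙yz≈y∙xz _ _ _ ⟩
    a * coeff p i + (b * coeff q i + coeff (0# ∷ (p *ₚ q)) i)  ≈⟨ +-congˡ (coeff-∷*ₚ b p q i) ⟨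
    a * coeff p i + coeff ((b ∷ p) *ₚ q) i             ∎

  DegLT-mono : m ≤ n → ∀ {p} → DegLT p m → DegLT p n
  DegLT-mono m≤n hp i n≤i = hp i (≤-trans m≤n n≤i)

  DegLT-resp : ∀ {p q} → p ≈ₚ q → DegLT q n → DegLT p n
  DegLT-resp p≈q hq i n≤i = trans (p≈q i) (hq i n≤i)

  DegLT--ₚ : ∀ {p q} → DegLT p n → DegLT q n → DegLT (p -ₚ q) n
  DegLT--ₚ {p = p} {q} hp hq i n≤i =
    trans (coeff--ₚ p q i) (trans (+-cong (hp i n≤i) (-‿cong (hq i n≤i))) 0-0≈0)

  0∷-zero : ∀ {p} → DegLT p 0 → DegLT (0# ∷ p) 0
  0∷-zero hp zero    _ = refl
  0∷-zero hp (suc i) _ = hp i z≤n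

  *ₚ-zeroˡ : ∀ p q → DegLT p 0 → DegLT (p *ₚ q) 0
  *ₚ-zeroˡ []      q hp i _ = refl
  *ₚ-zeroˡ (a ∷ p) q hp i _ = trans (coeff-∷*ₚ a p q i)
    (+-zeros (trans (*-congʳ (hp 0 z≤n)) (zeroˡ _))
             (0∷-zero (*ₚ-zeroˡ p q (λ j _ → hp (suc j) z≤n)) i z≤n))

  *ₚ-zeroʳ : ∀ p q → DegLT q 0 → DegLT (p *ₚ q) 0
  *ₚ-zeroʳ []      q hq i _ = refl
  *ₚ-zeroʳ (a ∷ p) q hq i _ = trans (coeff-∷*ₚ a p q i)
    (+-zeros (trans (*-congˡ (hq i z≤n)) (zeroʳ a)) (0∷-zero (*ₚ-zeroʳ p q hq) i z≤n))

  DegLE-*ₚ : ∀ {a b} p q → DegLE p a → DegLE q b → DegLE (p *ₚ q) (a ℕ.+ b)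
  DegLE-*ₚ []      q hp hq i _ = refl
  DegLE-*ₚ {zero} (x ∷ p) q hp hq i b<i = trans (coeff-∷*ₚ x p q i)
    (+-zeros (trans (*-congˡ (hq i b<i)) (zeroʳ x))
             (0∷-zero (*ₚ-zeroˡ p q (λ j _ → hp (suc j) (s≤s z≤n))) i z≤n))
  DegLE-*ₚ {suc a} {b} (x ∷ p) q hp hq (suc i) (s≤s a+b<i) = trans (coeff-∷*ₚ x p q (suc i))
    (+-zeros (trans (*-congˡ (hq (suc i) (s≤s (≤-trans (m≤n+m b a) (<⇒≤ a+b<i))))) (zeroʳ x))
             (DegLE-*ₚ p q (λ j a<j → hp (suc j) (s≤s a<j)) hq i a+b<i))

  coeff-*ₚ-top : ∀ {a b} p q → DegLE p a → DegLE q b →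
                 coeff (p *ₚ q) (a ℕ.+ b) ≈ coeff p a * coeff q b
  coeff-*ₚ-top []      q hp hq = sym (zeroˡ _)
  coeff-*ₚ-top {zero}  {b} (x ∷ p) q hp hq = trans (coeff-∷*ₚ x p q b)
    (trans (+-congˡ (0∷-zero (*ₚ-zeroˡ p q (λ j _ → hp (suc j) (s≤s z≤n))) b z≤n))
           (+-identityʳ _))
  coeff-*ₚ-top {suc a} {b} (x ∷ p) q hp hq = trans (coeff-∷*ₚ x p q (suc (a ℕ.+ b)))
    (trans (+-congʳ (trans (*-congˡ (hq _ (s≤s (m≤n+m b a)))) (zeroʳ x)))
           (trans (+-identityˡ _) (coeff-*ₚ-top p q (λ j a<j → hp (suc j) (s≤s a<j)) hq)))

  cancel-top : ∀ {r s ρ} → coeff r m * ρ ≈ 1# → DegLE r m → DegLE s m →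
               DegLT (s -ₚ (coeff s m * ρ) ·ₚ r) m
  cancel-top {m} {r} {s} {ρ} rρ≈1 r≤m s≤m i m≤i with m≤n⇒m<n∨m≡n m≤i
  ... | inj₁ m<i = trans (coeff--ₚ s ((coeff s m * ρ) ·ₚ r) i)
                         (trans (+-cong (s≤m i m<i) (-‿cong ar≈0)) 0-0≈0)
    where
    ar≈0 : coeff ((coeff s m * ρ) ·ₚ r) i ≈ 0#
    ar≈0 = trans (coeff-·ₚ _ r i) (trans (*-congˡ (r≤m i m<i)) (zeroʳ _))
  ... | inj₂ ≡.refl = trans (coeff--ₚ s ((coeff s m * ρ) ·ₚ r) m) (x≈y⇒x∙y⁻¹≈ε (sym (begin
    coeff ((coeff s m * ρ) ·ₚ r) m  ≈⟨ coeff-·ₚ _ r m ⟩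
    coeff s m * ρ * coeff r m       ≈⟨ *-assoc _ ρ _ ⟩
    coeff s m * (ρ * coeff r m)     ≈⟨ *-congˡ (trans (*-comm ρ _) rρ≈1) ⟩
    coeff s m * 1#                  ≈⟨ *-identityʳ _ ⟩
    coeff s m                       ∎)))

  u-[v+w]≈u-w-v : ∀ u v w → u - (v + w) ≈ u - w - v
  u-[v+w]≈u-w-v u v w = begin
    u - (v + w)      ≈⟨ +-congˡ (⁻¹-∙-comm v w) ⟨
    u + (- v + - w)  ≈⟨ +-congˡ (+-comm (- v) (- w)) ⟩
    u + (- w + - v)  ≈⟨ +-assoc u (- w) (- v) ⟨
    u - w - v        ∎

  remainder-step : ∀ x p r a c →
    ((x ∷ p) -ₚ r *ₚ (a ∷ c)) ≈ₚ ((x ∷ (p -ₚ r *ₚ c)) -ₚ a ·ₚ r)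
  remainder-step x p r a c i = begin
    coeff ((x ∷ p) -ₚ r *ₚ (a ∷ c)) i                         ≈⟨ coeff--ₚ (x ∷ p) (r *ₚ (a ∷ c)) i ⟩
    coeff (x ∷ p) i - coeff (r *ₚ (a ∷ c)) i                  ≈⟨ +-congˡ (-‿cong (coeff-*ₚ∷ r a c i)) ⟩
    coeff (x ∷ p) i - (a * coeff r i + coeff (0# ∷ (r *ₚ c)) i)  ≈⟨ shifted i ⟩
    coeff (x ∷ (p -ₚ r *ₚ c)) i - a * coeff r i                ≈⟨ +-congˡ (-‿cong (coeff-·ₚ a r i)) ⟨
    coeff (x ∷ (p -ₚ r *ₚ c)) i - coeff (a ·ₚ r) i             ≈⟨ coeff--ₚ (x ∷ (p -ₚ r *ₚ c)) (a ·ₚ r) i ⟨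
    coeff ((x ∷ (p -ₚ r *ₚ c)) -ₚ a ·ₚ r) i                    ∎
    where
    shifted : ∀ i → coeff (x ∷ p) i - (a * coeff r i + coeff (0# ∷ (r *ₚ c)) i)
                  ≈ coeff (x ∷ (p -ₚ r *ₚ c)) i - a * coeff r i
    shifted zero    = +-congˡ (-‿cong (+-identityʳ _))
    shifted (suc j) = trans (u-[v+w]≈u-w-v _ _ _) (+-congʳ (sym (coeff--ₚ p (r *ₚ c) j)))

  divide : ∀ {r ρ} → coeff r m * ρ ≈ 1# → DegLE r m →
           ∀ p → Σ Poly λ c → DegLT (p -ₚ r *ₚ c) m
  divide {m} {r} rρ≈1 r≤m [] =
    [] , DegLT--ₚ {p = []} {r *ₚ []} (λ _ _ → refl)
                  (DegLT-mono z≤n {r *ₚ []} (*ₚ-zeroʳ r [] (λ _ _ → refl)))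
  divide {m} {r} {ρ} rρ≈1 r≤m (x ∷ p) with divide {r = r} rρ≈1 r≤m p
  ... | c , p-rc<m = a ∷ c , DegLT-resp {p = (x ∷ p) -ₚ r *ₚ (a ∷ c)} {s -ₚ a ·ₚ r}
                               (remainder-step x p r a c) (cancel-top {r = r} {s} rρ≈1 r≤m s≤m)
    where
    s : Poly
    s = x ∷ (p -ₚ r *ₚ c)
    a : Carrier
    a = coeff s m * ρ
    s≤m : DegLE s m
    s≤m (suc j) (s≤s m≤j) = p-rc<m j m≤j

  private
    n+2+[m+m]≡n+2*[1+m] : ∀ n m → n ℕ.+ 2 ℕ.+ (m ℕ.+ m) ≡ n ℕ.+ 2 ℕ.* suc m
    n+2+[m+m]≡n+2*[1+m] = solve-∀

  -- N_{K/𝒬}(s + tY) = s² − f t²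
  normₚ : Poly → Poly → Poly → Poly
  normₚ f s t = s *ₚ s -ₚ f *ₚ (t *ₚ t)

  normₚ-DegLE : ∀ {n m} f s t → DegLE f (n ℕ.+ 2) → DegLT s m → DegLT t m →
                DegLE (normₚ f s t) (n ℕ.+ 2 ℕ.* m)
  normₚ-DegLE {n} {zero} f s t _ s≈0 t≈0 =
    DegLT-mono z≤n {normₚ f s t} (DegLT--ₚ {p = s *ₚ s} {f *ₚ (t *ₚ t)}
      (*ₚ-zeroˡ s s s≈0) (*ₚ-zeroʳ f (t *ₚ t) (*ₚ-zeroˡ t t t≈0)))
  normₚ-DegLE {n} {suc m} f s t f≤n+2 s≤m t≤m = DegLT--ₚ {p = s *ₚ s} {f *ₚ (t *ₚ t)}
    (DegLT-mono (s≤s (≤-trans (m≤n+m (m ℕ.+ m) (n ℕ.+ 2)) (≤-reflexive degrees))) {s *ₚ s}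
      (DegLE-*ₚ s s s≤m s≤m))
    (DegLT-mono (s≤s (≤-reflexive degrees)) {f *ₚ (t *ₚ t)}
      (DegLE-*ₚ f (t *ₚ t) f≤n+2 (DegLE-*ₚ t t t≤m t≤m)))
    where
    degrees : n ℕ.+ 2 ℕ.+ (m ℕ.+ m) ≡ n ℕ.+ 2 ℕ.* suc m
    degrees = n+2+[m+m]≡n+2*[1+m] n m

  -- Equality in k need not be decidable, so a polynomial has a degree only up
  -- to double negation; this suffices for proving ⊥.
  ¬¬-zero-or-degree : ∀ p → ¬ ¬ (DegLT p 0 ⊎ ∃ (DegEq p))
  ¬¬-zero-or-degree []      k = k (inj₁ λ _ _ → refl)
  ¬¬-zero-or-degree (x ∷ p) k = ¬¬-zero-or-degree p λ where
    (inj₁ p≈0) → ¬¬-excluded-middle {A = x ≈ 0#} λ where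
      (yes x≈0) → k (inj₁ λ { zero _ → x≈0 ; (suc i) _ → p≈0 i z≤n })
      (no x≉0)  → k (inj₂ (0 , (λ { (suc i) _ → p≈0 i z≤n }) , x≉0))
    (inj₂ (n , p≤n , pₙ≉0)) → k (inj₂ (suc n , (λ { (suc i) (s≤s n<i) → p≤n i n<i }) , pₙ≉0))

  ¬normₚ-DegLT-top : ∀ {n e} f s t → DegEq f n → ¬ IsSquare (coeff f n) → DegEq t e →
                     ¬ DegLT (normₚ f s t) (n ℕ.+ (e ℕ.+ e))
  ¬normₚ-DegLT-top {n} {e} f s t (f≤n , fₙ≉0) nonsquare (t≤e , tₑ≉0) N<D =
    ¬¬-zero-or-degree s λ where
      (inj₁ s≈0)               → s²-vanishes-at-D (*ₚ-zeroˡ s s s≈0 D z≤n)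
      (inj₂ (a , s≤a , sₐ≉0)) → compare-tops a s≤a sₐ≉0
    where
    D : ℕ
    D = n ℕ.+ (e ℕ.+ e)
    t²≤2e : DegLE (t *ₚ t) (e ℕ.+ e)
    t²≤2e = DegLE-*ₚ t t t≤e t≤e
    ft²≤D : DegLE (f *ₚ (t *ₚ t)) D
    ft²≤D = DegLE-*ₚ f (t *ₚ t) f≤n t²≤2e
    ft²-top : coeff (f *ₚ (t *ₚ t)) D ≈ coeff f n * (coeff t e * coeff t e)
    ft²-top = trans (coeff-*ₚ-top f (t *ₚ t) f≤n t²≤2e) (*-congˡ (coeff-*ₚ-top t t t≤e t≤e))
    s²≈ft² : ∀ j → D ≤ j → coeff (s *ₚ s) j ≈ coeff (f *ₚ (t *ₚ t)) j
    s²≈ft² j D≤j = x∙y⁻¹≈ε⇒x≈y _ _ (trans (sym (coeff--ₚ (s *ₚ s) (f *ₚ (t *ₚ t)) j)) (N<D j D≤j))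
    s²-vanishes-at-D : coeff (s *ₚ s) D ≈ 0# → ⊥
    s²-vanishes-at-D s²_D≈0 = *-nonzero fₙ≉0 (*-nonzero tₑ≉0 tₑ≉0)
      (trans (sym ft²-top) (trans (sym (s²≈ft² D ≤-refl)) s²_D≈0))
    compare-tops : ∀ a → DegLE s a → ¬ coeff s a ≈ 0# → ⊥
    compare-tops a s≤a sₐ≉0 with <-cmp (a ℕ.+ a) D
    ... | tri< 2a<D _ _ = s²-vanishes-at-D (DegLE-*ₚ s s s≤a s≤a D 2a<D)
    ... | tri> _ _ D<2a = *-nonzero sₐ≉0 sₐ≉0 (begin
      coeff s a * coeff s a            ≈⟨ coeff-*ₚ-top s s s≤a s≤a ⟨
      coeff (s *ₚ s) (a ℕ.+ a)         ≈⟨ s²≈ft² (a ℕ.+ a) (<⇒≤ D<2a) ⟩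
      coeff (f *ₚ (t *ₚ t)) (a ℕ.+ a)  ≈⟨ ft²≤D (a ℕ.+ a) D<2a ⟩
      0#                               ∎)
    ... | tri≈ _ 2a≡D _ with inverse (coeff t e) tₑ≉0
    ...   | β , tₑβ≈1 = nonsquare (square-of-ratio tₑβ≈1 (begin
      coeff s a * coeff s a               ≈⟨ coeff-*ₚ-top s s s≤a s≤a ⟨
      coeff (s *ₚ s) (a ℕ.+ a)            ≈⟨ s²≈ft² (a ℕ.+ a) (≤-reflexive (≡.sym 2a≡D)) ⟩
      coeff (f *ₚ (t *ₚ t)) (a ℕ.+ a)     ≡⟨ ≡.cong (coeff (f *ₚ (t *ₚ t))) 2a≡D ⟩
      coeff (f *ₚ (t *ₚ t)) D             ≈⟨ ft²-top ⟩
      coeff f n * (coeff t e * coeff t e)  ∎))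

  ¬normₚ-DegLT : ∀ {n} f s t → DegEq f n → ¬ IsSquare (coeff f n) → ¬ DegLT t 0 →
                 ¬ DegLT (normₚ f s t) n
  ¬normₚ-DegLT {n} f s t f≐n nonsquare t≉0 N<n = ¬¬-zero-or-degree t λ where
    (inj₁ t≈0)        → t≉0 t≈0
    (inj₂ (e , t≐e)) → ¬normₚ-DegLT-top f s t f≐n nonsquare t≐e
                          (DegLT-mono (m≤m+n n (e ℕ.+ e)) {normₚ f s t} N<n)

  X : Poly
  X = 0# ∷ 1# ∷ []

  X-DegEq : DegEq X 1
  X-DegEq = (λ { (suc (suc i)) _ → refl ; (suc zero) (s≤s ()) }) , 1≉0

  1-X*ₚ-nonzero : ∀ d → ¬ DegLT (oneₚ -ₚ X *ₚ d) 0
  1-X*ₚ-nonzero d 1-Xd≈0 = 1≉0 (begin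
    1#                            ≈⟨ +-identityʳ 1# ⟨
    1# + 0#                       ≈⟨ +-congˡ (trans (-‿cong Xd₀≈0) ε⁻¹≈ε) ⟨
    1# - coeff (X *ₚ d) 0         ≈⟨ coeff--ₚ oneₚ (X *ₚ d) 0 ⟨
    coeff (oneₚ -ₚ X *ₚ d) 0      ≈⟨ 1-Xd≈0 0 z≤n ⟩
    0#                            ∎)
    where
    Xd₀≈0 : coeff (X *ₚ d) 0 ≈ 0#
    Xd₀≈0 = trans (coeff-∷*ₚ 0# (1# ∷ []) d 0) (+-zeros (zeroˡ _) refl)

  exists-close-integral : ∀ {n} f → DegLE f (n ℕ.+ 2) → ∀ p q r m → DegEq r m →
                          Σ Poly λ c → Σ Poly λ d → NormDegLE f p q r m c d n
  exists-close-integral f f≤n+2 p q r m (r≤m , rₘ≉0) with inverse (coeff r m) rₘ≉0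
  ... | ρ , rₘρ≈1 with divide {r = r} rₘρ≈1 r≤m p | divide {r = r} rₘρ≈1 r≤m q
  ... | c , s<m | d , t<m = c , d , normₚ-DegLE f (p -ₚ r *ₚ c) (q -ₚ r *ₚ d) f≤n+2 s<m t<m

  Y/X-not-close : ∀ {n} f → DegEq f (suc n ℕ.+ 2) → ¬ IsSquare (coeff f (suc n ℕ.+ 2)) →
                  ∀ c d → ¬ NormDegLE f [] oneₚ X 1 c d n
  Y/X-not-close f f≐n+3 nonsquare c d =
    ¬normₚ-DegLT f ([] -ₚ X *ₚ c) (oneₚ -ₚ X *ₚ d) f≐n+3 nonsquare (1-X*ₚ-nonzero d)

open import Defs hiding (Field)
open import Data.Nat using (_+_; _*_; _≥_)

-- Characteristic ≠ 2, perfectness of k and separability of f make 𝒞 a smooth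
-- curve of genus g; the degree computation for norms does not use them.
theorem10 : ∀ {c ℓ : Level} (F : Field c ℓ) →
    CharNot2 F → Perfect F →
    (g : ℕ) → g ≥ 1 →
    (f : Poly F) → DegEq F f (2 * g + 2) → ¬ IsSquare F (coeff F f (2 * g + 2)) →
    Separable F f →
    EuclideanMinimumIs F f (2 * g)
-- g ≥ 1 makes 2 * g reduce to suc (pred (2 * g)), the shape Y/X-not-close needs.
theorem10 F _ _ (suc g) _ f f≐2g+2 nonsquare _ =
  exists-close-integral F f (proj₁ f≐2g+2) ,
  ([] , oneₚ F , X F , 1 , X-DegEq F , Y/X-not-close F f f≐2g+2 nonsquare)
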